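{- A pseudo BCK-algebra $A$ is commutative if and only if $\{1\}$ is a commutative deductive system of $A$.
   Context: A pseudo BCK-algebra is an algebra $(A,\rightarrow,\rightsquigarrow,1)$ of type $(2,2,0)$ such that for all $x,y,z\in A$: $(x\rightarrow y)\rightsquigarrow[(y\rightarrow z)\rightsquigarrow(x\rightarrow z)]=1$; $(x\rightsquigarrow y)\rightarrow[(y\rightsquigarrow z)\rightarrow(x\rightsquigarrow z)]=1$; $1\rightarrow x=x$; $1\rightsquigarrow x=x$; $x\rightarrow 1=1$; and if $x\rightarrow y=1$ and $y\rightarrow x=1$ then $x=y$. The order is $x\le y$ iff $x\rightarrow y=1$ (iff $x\rightsquigarrow y=1$). $A$ is commutative if $(x\rightarrow y)\rightsquigarrow y=(y\rightarrow x)\rightsquigarrow x$ and $(x\rightsquigarrow y)\rightarrow y=(y\rightsquigarrow x)\rightarrow x$ for all $x,y$. A deductive system of $A$ is a subset $D\subseteq A$ with $1\in D$ such that $x\in D$ and $x\rightarrow y\in D$ imply $y\in D$. A deductive system $D$ is commutative if for all $x,y\in A$: $y\rightarrow x\in D$ implies $((x\rightarrow y)\rightsquigarrow y)\rightarrow x\in D$, and $y\rightsquigarrow x\in D$ implies $((x\rightsquigarrow y)\rightarrow y)\rightsquigarrow x\in D$. -}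

module Defs where

open import Level using (Level; suc; _⊔_)
open import Relation.Binary.PropositionalEquality using (_≡_)
open import Data.Product using (_×_)

record PseudoBCK (a : Level) : Set (suc a) where
  infixr 5 _⇒_ _⇝_
  field
    Carrier : Set a
    _⇒_     : Carrier → Carrier → Carrier
    _⇝_     : Carrier → Carrier → Carrier
    one     : Carrier
    ax1 : ∀ x y z → (x ⇒ y) ⇝ ((y ⇒ z) ⇝ (x ⇒ z)) ≡ one
    ax2 : ∀ x y z → (x ⇝ y) ⇒ ((y ⇝ z) ⇒ (x ⇝ z)) ≡ one
    one⇒ : ∀ x → one ⇒ x ≡ x
    one⇝ : ∀ x → one ⇝ x ≡ x
    ⇒one : ∀ x → x ⇒ one ≡ one
    antisym : ∀ x y → x ⇒ y ≡ one → y ⇒ x ≡ one → x ≡ y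

module _ {a : Level} (A : PseudoBCK a) where
  open PseudoBCK A

  IsCommutative : Set a
  IsCommutative =
    ∀ x y → ((x ⇒ y) ⇝ y ≡ (y ⇒ x) ⇝ x) × ((x ⇝ y) ⇒ y ≡ (y ⇝ x) ⇒ x)

  IsDeductiveSystem : {ℓ : Level} → (Carrier → Set ℓ) → Set (a ⊔ ℓ)
  IsDeductiveSystem D = D one × (∀ x y → D x → D (x ⇒ y) → D y)

  IsCommutativeDS : {ℓ : Level} → (Carrier → Set ℓ) → Set (a ⊔ ℓ)
  IsCommutativeDS D =
    IsDeductiveSystem D ×
    ((∀ x y → D (y ⇒ x) → D (((x ⇒ y) ⇝ y) ⇒ x)) ×
     (∀ x y → D (y ⇝ x) → D (((x ⇝ y) ⇒ y) ⇝ x)))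

  Singleton1 : Carrier → Set a
  Singleton1 x = x ≡ one

-- For y ≤ x the element (x → y) ⇝ y lies above x, so {1} being commutative says exactly
-- that (x → y) ⇝ y = x whenever y ≤ x. Applying this to y ≤ w and x ≤ w with
-- w = (y → x) ⇝ x, antitonicity of → and ⇝ in their first argument gives
-- (x → y) ⇝ y ≤ (w → y) ⇝ y = w, and symmetry yields commutativity. Swapping → and ⇝
-- gives again a pseudo BCK-algebra, which transfers the argument to the second identity.
module Submission where

open import Defs
open import Level using (Level)
open import Function.Bundles using (_⇔_; mk⇔; module Equivalence)
open import Data.Product using (_,_; proj₁; proj₂)
open import Relation.Binary.PropositionalEquality
  using (_≡_; refl; sym; trans; cong; subst; subst₂; module ≡-Reasoning)

module Properties {a : Level} (A : PseudoBCK a) where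
  open PseudoBCK A
  open ≡-Reasoning

  infix 4 _≤_
  _≤_ : Carrier → Carrier → Set a
  x ≤ y = x ⇒ y ≡ one

  one≤⇒≡one : ∀ {x} → one ≤ x → x ≡ one
  one≤⇒≡one {x} one≤x = trans (sym (one⇒ x)) one≤x

  x⇝[x⇒y]⇝y≡one : ∀ x y → x ⇝ ((x ⇒ y) ⇝ y) ≡ one
  x⇝[x⇒y]⇝y≡one x y = subst₂ (λ u v → u ⇝ ((x ⇒ y) ⇝ v) ≡ one) (one⇒ x) (one⇒ y) (ax1 one x y)

  x≤[x⇝y]⇒y : ∀ x y → x ≤ (x ⇝ y) ⇒ y
  x≤[x⇝y]⇒y x y = subst₂ (λ u v → u ⇒ ((x ⇝ y) ⇒ v) ≡ one) (one⇝ x) (one⇝ y) (ax2 one x y)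

  ≤⇒⇝≡one : ∀ {x y} → x ≤ y → x ⇝ y ≡ one
  ≤⇒⇝≡one {x} {y} x≤y = begin
    x ⇝ y                  ≡⟨ cong (x ⇝_) (sym (one⇝ y)) ⟩
    x ⇝ (one ⇝ y)          ≡⟨ cong (λ t → x ⇝ (t ⇝ y)) (sym x≤y) ⟩
    x ⇝ ((x ⇒ y) ⇝ y)      ≡⟨ x⇝[x⇒y]⇝y≡one x y ⟩
    one                    ∎

  ⇝≡one⇒≤ : ∀ {x y} → x ⇝ y ≡ one → x ≤ y
  ⇝≡one⇒≤ {x} {y} x⇝y≡one = begin
    x ⇒ y                  ≡⟨ cong (x ⇒_) (sym (one⇒ y)) ⟩
    x ⇒ (one ⇒ y)          ≡⟨ cong (λ t → x ⇒ (t ⇒ y)) (sym x⇝y≡one) ⟩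
    x ⇒ ((x ⇝ y) ⇒ y)      ≡⟨ x≤[x⇝y]⇒y x y ⟩
    one                    ∎

  x≤[x⇒y]⇝y : ∀ x y → x ≤ (x ⇒ y) ⇝ y
  x≤[x⇒y]⇝y x y = ⇝≡one⇒≤ (x⇝[x⇒y]⇝y≡one x y)

  ≤-refl : ∀ x → x ≤ x
  ≤-refl x = subst (λ t → t ⇒ x ≡ one) (one⇝ x) (one≤⇒≡one (x≤[x⇝y]⇒y one x))

  y≤x⇝y : ∀ x y → y ≤ x ⇝ y
  y≤x⇝y x y =
    one≤⇒≡one (subst₂ (λ u v → u ⇒ (v ⇒ (x ⇝ y)) ≡ one) (≤⇒⇝≡one (⇒one x)) (one⇝ y) (ax2 x one y))

  ⇒-antitoneˡ : ∀ {x y} z → x ≤ y → y ⇒ z ≤ x ⇒ z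
  ⇒-antitoneˡ {x} {y} z x≤y =
    ⇝≡one⇒≤ (trans (sym (one⇝ _)) (subst (λ t → t ⇝ ((y ⇒ z) ⇝ (x ⇒ z)) ≡ one) x≤y (ax1 x y z)))

  ⇝-antitoneˡ : ∀ {x y} z → x ≤ y → y ⇝ z ≤ x ⇝ z
  ⇝-antitoneˡ {x} {y} z x≤y =
    one≤⇒≡one (subst (λ t → t ⇒ ((y ⇝ z) ⇒ (x ⇝ z)) ≡ one) (≤⇒⇝≡one x≤y) (ax2 x y z))

  Commutative⇒ : Set a
  Commutative⇒ = ∀ x y → (x ⇒ y) ⇝ y ≡ (y ⇒ x) ⇝ x

  OneCommutative⇒ : Set a
  OneCommutative⇒ = ∀ x y → y ≤ x → (x ⇒ y) ⇝ y ≤ x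

  commutative⇒⇔oneCommutative⇒ : Commutative⇒ ⇔ OneCommutative⇒
  commutative⇒⇔oneCommutative⇒ = mk⇔ to from
    where
    to : Commutative⇒ → OneCommutative⇒
    to comm x y y≤x = subst (_≤ x) (sym [x⇒y]⇝y≡x) (≤-refl x)
      where
      [x⇒y]⇝y≡x : (x ⇒ y) ⇝ y ≡ x
      [x⇒y]⇝y≡x = begin
        (x ⇒ y) ⇝ y        ≡⟨ comm x y ⟩
        (y ⇒ x) ⇝ x        ≡⟨ cong (_⇝ x) y≤x ⟩
        one ⇝ x            ≡⟨ one⇝ x ⟩
        x                  ∎

    module _ (oneComm : OneCommutative⇒) where
      [x⇒y]⇝y≡x : ∀ {x y} → y ≤ x → (x ⇒ y) ⇝ y ≡ x
      [x⇒y]⇝y≡x {x} {y} y≤x = antisym _ _ (oneComm x y y≤x) (x≤[x⇒y]⇝y x y)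

      [x⇒y]⇝y≤[y⇒x]⇝x : ∀ x y → (x ⇒ y) ⇝ y ≤ (y ⇒ x) ⇝ x
      [x⇒y]⇝y≤[y⇒x]⇝x x y =
        subst ((x ⇒ y) ⇝ y ≤_) ([x⇒y]⇝y≡x (x≤[x⇒y]⇝y y x))
              (⇝-antitoneˡ y (⇒-antitoneˡ y (y≤x⇝y (y ⇒ x) x)))

      from : Commutative⇒
      from x y = antisym _ _ ([x⇒y]⇝y≤[y⇒x]⇝x x y) ([x⇒y]⇝y≤[y⇒x]⇝x y x)

dual : {a : Level} → PseudoBCK a → PseudoBCK a
dual A = record
  { Carrier = Carrier ; _⇒_ = _⇝_ ; _⇝_ = _⇒_ ; one = one
  ; ax1 = ax2 ; ax2 = ax1 ; one⇒ = one⇝ ; one⇝ = one⇒ ; ⇒one = λ x → ≤⇒⇝≡one (⇒one x)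
  ; antisym = λ x y x⇝y≡one y⇝x≡one → antisym x y (⇝≡one⇒≤ x⇝y≡one) (⇝≡one⇒≤ y⇝x≡one)
  }
  where
  open PseudoBCK A
  open Properties A

singleton1-isDeductiveSystem : {a : Level} (A : PseudoBCK a) → IsDeductiveSystem A (Singleton1 A)
singleton1-isDeductiveSystem A = refl , λ x y x≡one x⇒y≡one →
  one≤⇒≡one (subst (λ t → t ⇒ y ≡ one) x≡one x⇒y≡one)
  where
  open PseudoBCK A
  open Properties A

theorem4p7 : {a : Level} (A : PseudoBCK a) →
    IsCommutative A ⇔ IsCommutativeDS A (Singleton1 A)
theorem4p7 A = mk⇔
  (λ comm → singleton1-isDeductiveSystem A
          , Equivalence.to sides⇒ (λ x y → proj₁ (comm x y))
          , Equivalence.to sides⇝ (λ x y → proj₂ (comm x y)))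
  (λ { (_ , oneComm⇒ , oneComm⇝) x y →
          Equivalence.from sides⇒ oneComm⇒ x y , Equivalence.from sides⇝ oneComm⇝ x y })
  where
  sides⇒ : Properties.Commutative⇒ A ⇔ Properties.OneCommutative⇒ A
  sides⇒ = Properties.commutative⇒⇔oneCommutative⇒ A
  sides⇝ : Properties.Commutative⇒ (dual A) ⇔ Properties.OneCommutative⇒ (dual A)
  sides⇝ = Properties.commutative⇒⇔oneCommutative⇒ (dual A)
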